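{- Let $n \ge 2$. In All-but-one-delete Nim with $n$ heaps, the position $\langle z_1, z_2, \ldots, z_n \rangle$ (with $z_1,\ldots,z_n$ positive integers) is a $\mathcal{P}$-position if and only if for every $i \in \{1,\ldots,n\}$, the remainder of $z_i$ upon division by $n(n-1)$ lies between $1$ and $n-1$ (inclusive).
   Context: All-but-one-delete Nim with $n$ heaps: a position is an $n$-tuple $\langle z_1,\ldots,z_n\rangle$ of positive integers (heap sizes). Two players alternate moves. A move consists of selecting $n-1$ of the heaps and deleting them, and then splitting the one remaining heap into $n$ heaps, each containing at least one token (so the new position again consists of $n$ positive integers summing to the size of the kept heap). Normal play convention: a player who cannot move loses. A $\mathcal{P}$-position is a position from which the player about to move has no winning strategy (equivalently, the previous player can force a win). -}

module Defs where

open import Data.Nat using (ℕ; zero; suc; _*_; _∸_; _≤_; s≤s; z≤n; NonZero)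
open import Data.Nat.DivMod using (_%_)
open import Data.Vec using (Vec; lookup; sum)
open import Data.Vec.Relation.Unary.All using (All)
open import Data.Fin using (Fin)
open import Data.Product using (Σ; _×_)
open import Relation.Binary.PropositionalEquality using (_≡_)

Position : ℕ → Set
Position n = Vec ℕ n

Positive : ∀ {n} → Position n → Set
Positive z = All (λ x → 1 ≤ x) z

-- A move from p to q: keep heap i of p (delete the other n-1 heaps) and split
-- it into the n positive heaps of q.
Move : ∀ {n} → Position n → Position n → Set
Move {n} p q = Σ (Fin n) λ i → Positive q × sum q ≡ lookup p i

-- P-positions and N-positions, defined inductively (the game is finite since
-- the total number of tokens strictly decreases, so this is the usual
-- normal-play classification).
mutual
  data IsP {n : ℕ} (p : Position n) : Set where
    allMovesToN : (∀ q → Move p q → IsN q) → IsP p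

  data IsN {n : ℕ} (p : Position n) : Set where
    moveToP : (q : Position n) → Move p q → IsP q → IsN p

nonZero-n[n-1] : ∀ n → 2 ≤ n → NonZero (n * (n ∸ 1))
nonZero-n[n-1] (suc (suc m)) (s≤s (s≤s z≤n)) = _

remNN : (n : ℕ) → 2 ≤ n → ℕ → ℕ
remNN n h x = _%_ x (n * (n ∸ 1)) {{nonZero-n[n-1] n h}}

{-# OPTIONS --safe #-}
-- Write M = n(n-1) and call a heap small if its residue mod M lies in [1, n-1].
-- The sum of n small heaps has residue in {0} ∪ [n, M] mod M, since the n
-- residues add up to a number between n and n(n-1) = M; so a move from a
-- position of small heaps never reaches one.  Conversely a positive heap that
-- is not small is r + tM with n ≤ r ≤ M, and splitting r into n parts in
-- [1, n-1] and adding tM to one of them is a move to small heaps.  As every move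
-- strictly decreases the number of tokens, the positions of small heaps are
-- exactly the P-positions.
module Submission where

open import Defs
open import Data.Nat using (ℕ; zero; suc; _+_; _*_; _∸_; _≤_; _<_; _/_; _%_; s≤s; z≤n; NonZero; _≤?_; _≟_)
open import Data.Nat.Properties
open import Data.Nat.DivMod
open import Data.Product using (∃; _×_; _,_; proj₁; proj₂)
open import Data.Sum using (inj₁; inj₂)
open import Data.Vec using (Vec; []; _∷_; lookup; sum)
open import Data.Vec.Relation.Unary.All as All using (All; []; _∷_; all?)
open import Data.Vec.Relation.Unary.All.Properties using (lookup⁺)
open import Data.Fin using (zero; suc)
open import Data.Empty using (⊥-elim)
open import Relation.Nullary using (¬_; yes; no)
open import Relation.Nullary.Decidable using (_×-dec_)
open import Relation.Unary using (Decidable)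
open import Relation.Binary.PropositionalEquality
open import Function.Bundles using (_⇔_; mk⇔)
open import Algebra.Properties.CommutativeSemigroup +-commutativeSemigroup using (x∙yz≈y∙xz; xy∙z≈xz∙y)

lookup≤sum : ∀ {k} (v : Vec ℕ k) i → lookup v i ≤ sum v
lookup≤sum (x ∷ v) zero    = m≤m+n x (sum v)
lookup≤sum (x ∷ v) (suc i) = ≤-trans (lookup≤sum v i) (m≤n+m (sum v) x)

lookup<sum : ∀ {k} (v : Vec ℕ (suc (suc k))) → Positive v → ∀ i → lookup v i < sum v
lookup<sum (x ∷ y ∷ w) (_ ∷ 1≤y ∷ _) zero = m<m+n x (≤-trans 1≤y (m≤m+n y (sum w)))
lookup<sum (x ∷ v) (1≤x ∷ _) (suc i) = ≤-trans (s≤s (lookup≤sum v i)) (+-monoˡ-≤ (sum v) 1≤x)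

¬All⇒∃¬lookup : ∀ {P : ℕ → Set} → Decidable P →
  ∀ {k} (v : Vec ℕ k) → ¬ All P v → ∃ λ i → ¬ P (lookup v i)
¬All⇒∃¬lookup P? []      ¬all = ⊥-elim (¬all [])
¬All⇒∃¬lookup P? (x ∷ v) ¬all with P? x
... | no ¬px = zero , ¬px
... | yes px with ¬All⇒∃¬lookup P? v (λ all → ¬all (px ∷ all))
...   | i , ¬p = suc i , ¬p

IsP⇒¬IsN : ∀ {n} {p : Position n} → IsP p → ¬ IsN p
IsP⇒¬IsN (allMovesToN toN) (moveToP q p→q isP) = IsP⇒¬IsN isP (toN q p→q)

move-decreases-sum : ∀ {k} {p q : Position (suc (suc k))} → Positive p → Move p q → sum q < sum p
move-decreases-sum {p = p} pos (i , _ , sum≡) = subst (_< sum p) (sym sum≡) (lookup<sum p pos i)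

module PPositionCharacterisation
  {k : ℕ} (Good : Position (suc (suc k)) → Set) (good? : Decidable Good)
  (good⇒¬moveToGood : ∀ {p q} → Good p → Move p q → ¬ Good q)
  (¬good⇒moveToGood : ∀ {p} → Positive p → ¬ Good p → ∃ λ q → Move p q × Good q)
  where

  private
    Classified : Position (suc (suc k)) → Set
    Classified p = (Good p → IsP p) × (¬ Good p → IsN p)

    classify : ∀ b p → Positive p → sum p < b → Classified p
    classify (suc b) p pos (s≤s sum<b) = good⇒IsP , ¬good⇒IsN
      where
      classifySuccessor : ∀ {q} → Move p q → Classified q
      classifySuccessor p→q@(_ , posq , _) =
        classify b _ posq (≤-trans (move-decreases-sum pos p→q) sum<b)

      good⇒IsP : Good p → IsP p
      good⇒IsP good = allMovesToN λ q p→q →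
        proj₂ (classifySuccessor p→q) (good⇒¬moveToGood good p→q)

      ¬good⇒IsN : ¬ Good p → IsN p
      ¬good⇒IsN ¬good with ¬good⇒moveToGood pos ¬good
      ... | q , p→q , goodq = moveToP q p→q (proj₁ (classifySuccessor p→q) goodq)

  IsP⇔Good : ∀ p → Positive p → IsP p ⇔ Good p
  IsP⇔Good p pos = mk⇔ IsP⇒Good good⇒IsP
    where
    good⇒IsP : Good p → IsP p
    good⇒IsP = proj₁ (classify (suc (sum p)) p pos ≤-refl)

    IsP⇒Good : IsP p → Good p
    IsP⇒Good isP with good? p
    ... | yes good = good
    ... | no ¬good = ⊥-elim (IsP⇒¬IsN isP (proj₂ (classify (suc (sum p)) p pos ≤-refl) ¬good))

module _ (M : ℕ) .{{_ : NonZero M}} where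

  %-+-congʳ : ∀ x {y z} → y % M ≡ z % M → (x + y) % M ≡ (x % M + z) % M
  %-+-congʳ x {y} {z} y≡z = begin
    (x + y) % M               ≡⟨ %-distribˡ-+ x y M ⟩
    (x % M + y % M) % M       ≡⟨ cong (λ t → (t + y % M) % M) (m%n%n≡m%n x M) ⟨
    (x % M % M + y % M) % M   ≡⟨ cong (λ t → (x % M % M + t) % M) y≡z ⟩
    (x % M % M + z % M) % M   ≡⟨ %-distribˡ-+ (x % M) z M ⟨
    (x % M + z) % M           ∎
    where open ≡-Reasoning

  sum-residues : ∀ lo hi {k} (v : Vec ℕ k) → All (λ x → lo ≤ x % M × x % M ≤ hi) v →
    ∃ λ R → sum v % M ≡ R % M × k * lo ≤ R × R ≤ k * hi
  sum-residues lo hi []      []                = 0 , refl , z≤n , z≤n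
  sum-residues lo hi (x ∷ v) ((lo≤ , ≤hi) ∷ bounds) with sum-residues lo hi v bounds
  ... | R , sum≡R , lo≤R , R≤hi =
    x % M + R , %-+-congʳ x sum≡R , +-mono-≤ lo≤ lo≤R , +-mono-≤ ≤hi R≤hi

bounded-composition : ∀ c k e → e ≤ k * c →
  ∃ λ (v : Vec ℕ k) → All (λ x → 1 ≤ x × x ≤ suc c) v × sum v ≡ k + e
bounded-composition c zero    .zero z≤n = [] , [] , refl
bounded-composition c (suc k) e e≤ with e ≤? c
... | yes e≤c with bounded-composition c k 0 z≤n
...   | v , bounds , sum≡ =
  suc e ∷ v , (s≤s z≤n , s≤s e≤c) ∷ bounds ,
  cong suc (trans (cong (e +_) (trans sum≡ (+-identityʳ k))) (+-comm e k))
bounded-composition c (suc k) e e≤ | no e≰c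
  with bounded-composition c k (e ∸ c) (subst (e ∸ c ≤_) (m+n∸m≡n c (k * c)) (∸-monoˡ-≤ c e≤))
... | v , bounds , sum≡ = suc c ∷ v , (s≤s z≤n , ≤-refl) ∷ bounds , cong suc c+sum≡k+e
  where
  open ≡-Reasoning
  c+sum≡k+e : c + sum v ≡ k + e
  c+sum≡k+e = begin
    c + sum v         ≡⟨ cong (c +_) sum≡ ⟩
    c + (k + (e ∸ c)) ≡⟨ x∙yz≈y∙xz c k (e ∸ c) ⟩
    k + (c + (e ∸ c)) ≡⟨ cong (k +_) (m+[n∸m]≡n (<⇒≤ (≰⇒> e≰c))) ⟩
    k + e             ∎

module AllButOneDeleteNim (d : ℕ) where

  n M : ℕ
  n = suc (suc d)
  M = n * suc d

  Small : ℕ → Set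
  Small x = (1 ≤ remNN n (s≤s (s≤s z≤n)) x) × (remNN n (s≤s (s≤s z≤n)) x ≤ suc d)

  small? : Decidable Small
  small? x = (1 ≤? x % M) ×-dec (x % M ≤? suc d)

  M≡n+n*d : M ≡ n + n * d
  M≡n+n*d = *-suc n d

  ≤1+d⇒%M-id : ∀ {x} → x ≤ suc d → x % M ≡ x
  ≤1+d⇒%M-id x≤ = m<n⇒m%n≡m (≤-trans (s≤s x≤) (m<m+n (suc d) (s≤s z≤n)))

  sum-of-small-not-small : (q : Position n) → All Small q → ¬ Small (sum q)
  sum-of-small-not-small q smalls (1≤r , r≤1+d) with sum-residues M 1 (suc d) q smalls
  ... | R , sum≡R , n*1≤R , R≤M with m≤n⇒m<n∨m≡n R≤M
  ...   | inj₁ R<M = <⇒≱ (subst (_≤ R) (*-identityʳ n) n*1≤R)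
                       (subst (_≤ suc d) (trans sum≡R (m<n⇒m%n≡m R<M)) r≤1+d)
  ...   | inj₂ refl = <⇒≱ 1≤r (≤-reflexive (trans sum≡R (n%n≡0 M)))

  not-small-decomposition : ∀ {x} → 1 ≤ x → ¬ Small x →
    ∃ λ r → ∃ λ t → n ≤ r × r ≤ M × x ≡ r + t * M
  not-small-decomposition {x} 1≤x ¬small with x % M ≟ 0 | m≡m%n+[m/n]*n x M
  ... | yes r≡0 | x≡ with x / M
  ...   | zero  = ⊥-elim (<⇒≱ 1≤x (≤-reflexive (trans x≡ (cong (_+ 0) r≡0))))
  ...   | suc t = M , t , subst (n ≤_) (sym M≡n+n*d) (m≤m+n n (n * d)) , ≤-refl ,
                  trans x≡ (cong (_+ suc t * M) r≡0)
  not-small-decomposition {x} 1≤x ¬small | no r≢0 | x≡ =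
    x % M , x / M , n≤r , <⇒≤ (m%n<n x M) , x≡
    where
    n≤r : n ≤ x % M
    n≤r with x % M ≤? suc d
    ... | yes r≤1+d = ⊥-elim (¬small (n≢0⇒n>0 r≢0 , r≤1+d))
    ... | no r≰1+d = ≰⇒> r≰1+d

  small-resp-% : ∀ x y → x % M ≡ y % M → Small y → Small x
  small-resp-% _ _ x≡y = subst (λ r → 1 ≤ r × r ≤ suc d) (sym x≡y)

  part-small : ∀ {x} → 1 ≤ x × x ≤ suc d → Small x
  part-small part = subst (λ r → 1 ≤ r × r ≤ suc d) (sym (≤1+d⇒%M-id (proj₂ part))) part

  split-not-small : ∀ {x} → 1 ≤ x → ¬ Small x →
    ∃ λ (q : Position n) → Positive q × All Small q × sum q ≡ x
  split-not-small {x} 1≤x ¬small with not-small-decomposition 1≤x ¬small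
  ... | r , t , n≤r , r≤M , x≡r+tM with bounded-composition d n (r ∸ n) r∸n≤n*d
    where
    r∸n≤n*d : r ∸ n ≤ n * d
    r∸n≤n*d = subst (r ∸ n ≤_) (trans (cong (_∸ n) M≡n+n*d) (m+n∸m≡n n (n * d))) (∸-monoˡ-≤ n r≤M)
  ...   | a ∷ w , part-a ∷ parts , sum≡ =
    a + t * M ∷ w ,
    ≤-trans (proj₁ part-a) (m≤m+n a (t * M)) ∷ All.map proj₁ parts ,
    small-resp-% (a + t * M) a ([m+kn]%n≡m%n a t M) (part-small part-a) ∷ All.map part-small parts ,
    sum≡x
    where
    open ≡-Reasoning
    sum≡x : a + t * M + sum w ≡ x
    sum≡x = begin
      a + t * M + sum w   ≡⟨ xy∙z≈xz∙y a (t * M) (sum w) ⟩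
      a + sum w + t * M   ≡⟨ cong (_+ t * M) (trans sum≡ (m+[n∸m]≡n n≤r)) ⟩
      r + t * M           ≡⟨ x≡r+tM ⟨
      x                   ∎

  small-heaps⇒¬moveToSmallHeaps : ∀ {p q} → All Small p → Move p q → ¬ All Small q
  small-heaps⇒¬moveToSmallHeaps {q = q} smalls (i , _ , sum≡) smalls-q =
    sum-of-small-not-small q smalls-q (subst Small (sym sum≡) (lookup⁺ smalls i))

  ¬small-heaps⇒moveToSmallHeaps : ∀ {p} → Positive p → ¬ All Small p →
    ∃ λ q → Move p q × All Small q
  ¬small-heaps⇒moveToSmallHeaps {p} pos ¬smalls with ¬All⇒∃¬lookup small? p ¬smalls
  ... | i , ¬small with split-not-small (lookup⁺ pos i) ¬small
  ...   | q , pos-q , smalls-q , sum≡ = q , (i , pos-q , sum≡) , smalls-q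

  IsP⇔AllSmall : ∀ p → Positive p → IsP p ⇔ All Small p
  IsP⇔AllSmall = PPositionCharacterisation.IsP⇔Good (All Small) (all? small?)
    small-heaps⇒¬moveToSmallHeaps ¬small-heaps⇒moveToSmallHeaps

theorem3p2 : (n : ℕ) (h : 2 ≤ n) (z : Position n) → Positive z →
    (IsP z ⇔ All (λ x → (1 ≤ remNN n h x) × (remNN n h x ≤ n ∸ 1)) z)
theorem3p2 (suc (suc d)) (s≤s (s≤s z≤n)) = AllButOneDeleteNim.IsP⇔AllSmall d
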